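{- Let $(N,a)$ be one of the pairs $(26,13)$, $(28,-7)$, $(29,29)$, $(30,5)$, $(33,-11)$, $(35,5)$, $(39,13)$, $(40,-1)$, $(40,5)$, $(41,41)$, $(48,-1)$, $(48,3)$, $(50,5)$, and let $f_N$ be the polynomial listed in the context. Let $x_0\in\mathbb{Q}$ be such that $f_N(x_0)$ is not a square in $\mathbb{Q}$ and the point $(x_0,\sqrt{f_N(x_0)})$ on the model $y^2=f_N(x)$ of $X_0(N)$ is non-cuspidal, and let $K=\mathbb{Q}(\sqrt{f_N(x_0)})$. If a prime $p$ ramifies in $K$ (where for $(N,a)=(28,-7)$ one additionally assumes $p\neq 2$), then $a$ is a square modulo $p$.
   Context: For each $N$ the modular curve $X_0(N)$ is given by the hyperelliptic model $y^2=f_N(x)$ with: $f_{26}=x^6-8x^5+8x^4-18x^3+8x^2-8x+1$; $f_{28}=4x^6-12x^5+25x^4-30x^3+25x^2-12x+4$; $f_{29}=x^6-4x^5-12x^4+2x^3+8x^2+8x-7$; $f_{30}=x^8+14x^7+79x^6+242x^5+441x^4+484x^3+316x^2+112x+16$; $f_{33}=x^8+10x^6-8x^5+47x^4-40x^3+82x^2-44x+33$; $f_{35}=x^8-4x^7-6x^6-4x^5-9x^4+4x^3-6x^2+4x+1$; $f_{39}=x^8-6x^7+3x^6+12x^5-23x^4+12x^3+3x^2-6x+1$; $f_{40}=x^8+8x^6-2x^4+8x^2+1$; $f_{41}=x^8-4x^7-8x^6+10x^5+20x^4+8x^3-15x^2-20x-8$; $f_{48}=x^8+14x^4+1$; $f_{50}=x^6-4x^5-10x^3-4x+1$.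 A quadratic point of the form $(x_0,\sqrt{f_N(x_0)})$ with $x_0\in\mathbb{Q}$ is called non-exceptional; "non-cuspidal" means not a cusp of $X_0(N)$. -}

module Defs where

open import Data.Nat as ℕ using (ℕ)
open import Data.Integer as ℤ using (ℤ; +_; -[1+_]; ∣_∣; _%ℕ_)
import Data.Integer.Divisibility as ℤD
open import Data.Nat.Divisibility as ℕD using ()
open import Data.Rational as ℚ using (ℚ)
open import Data.List using (List; []; _∷_; foldr)
open import Data.Product using (Σ; ∃; _×_; _,_)
open import Relation.Binary.PropositionalEquality using (_≡_)

data Case : Set where
  c26-13 c28-m7 c29-29 c30-5 c33-m11 c35-5 c39-13
    c40-m1 c40-5 c41-41 c48-m1 c48-3 c50-5 : Case

level : Case → ℕ
level c26-13  = 26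
level c28-m7  = 28
level c29-29  = 29
level c30-5   = 30
level c33-m11 = 33
level c35-5   = 35
level c39-13  = 39
level c40-m1  = 40
level c40-5   = 40
level c41-41  = 41
level c48-m1  = 48
level c48-3   = 48
level c50-5   = 50

aOf : Case → ℤ
aOf c26-13  = + 13
aOf c28-m7  = ℤ.- (+ 7)
aOf c29-29  = + 29
aOf c30-5   = + 5
aOf c33-m11 = ℤ.- (+ 11)
aOf c35-5   = + 5
aOf c39-13  = + 13
aOf c40-m1  = ℤ.- (+ 1)
aOf c40-5   = + 5
aOf c41-41  = + 41
aOf c48-m1  = ℤ.- (+ 1)
aOf c48-3   = + 3
aOf c50-5   = + 5

-- Coefficients of f_N, listed from the constant term upwards
-- (c₀ ∷ c₁ ∷ … ∷ c_deg ∷ []), i.e. f = Σ cᵢ xⁱ.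
coeffs : Case → List ℤ
coeffs c26-13 = + 1 ∷ ℤ.- (+ 8) ∷ + 8 ∷ ℤ.- (+ 18) ∷ + 8 ∷ ℤ.- (+ 8) ∷ + 1 ∷ []
coeffs c28-m7 = + 4 ∷ ℤ.- (+ 12) ∷ + 25 ∷ ℤ.- (+ 30) ∷ + 25 ∷ ℤ.- (+ 12) ∷ + 4 ∷ []
coeffs c29-29 = ℤ.- (+ 7) ∷ + 8 ∷ + 8 ∷ + 2 ∷ ℤ.- (+ 12) ∷ ℤ.- (+ 4) ∷ + 1 ∷ []
coeffs c30-5 = + 16 ∷ + 112 ∷ + 316 ∷ + 484 ∷ + 441 ∷ + 242 ∷ + 79 ∷ + 14 ∷ + 1 ∷ []
coeffs c33-m11 = + 33 ∷ ℤ.- (+ 44) ∷ + 82 ∷ ℤ.- (+ 40) ∷ + 47 ∷ ℤ.- (+ 8) ∷ + 10 ∷ + 0 ∷ + 1 ∷ []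
coeffs c35-5 = + 1 ∷ + 4 ∷ ℤ.- (+ 6) ∷ + 4 ∷ ℤ.- (+ 9) ∷ ℤ.- (+ 4) ∷ ℤ.- (+ 6) ∷ ℤ.- (+ 4) ∷ + 1 ∷ []
coeffs c39-13 = + 1 ∷ ℤ.- (+ 6) ∷ + 3 ∷ + 12 ∷ ℤ.- (+ 23) ∷ + 12 ∷ + 3 ∷ ℤ.- (+ 6) ∷ + 1 ∷ []
coeffs c40-m1 = + 1 ∷ + 0 ∷ + 8 ∷ + 0 ∷ ℤ.- (+ 2) ∷ + 0 ∷ + 8 ∷ + 0 ∷ + 1 ∷ []
coeffs c40-5 = + 1 ∷ + 0 ∷ + 8 ∷ + 0 ∷ ℤ.- (+ 2) ∷ + 0 ∷ + 8 ∷ + 0 ∷ + 1 ∷ []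
coeffs c41-41 = ℤ.- (+ 8) ∷ ℤ.- (+ 20) ∷ ℤ.- (+ 15) ∷ + 8 ∷ + 20 ∷ + 10 ∷ ℤ.- (+ 8) ∷ ℤ.- (+ 4) ∷ + 1 ∷ []
coeffs c48-m1 = + 1 ∷ + 0 ∷ + 0 ∷ + 0 ∷ + 14 ∷ + 0 ∷ + 0 ∷ + 0 ∷ + 1 ∷ []
coeffs c48-3 = + 1 ∷ + 0 ∷ + 0 ∷ + 0 ∷ + 14 ∷ + 0 ∷ + 0 ∷ + 0 ∷ + 1 ∷ []
coeffs c50-5 = + 1 ∷ ℤ.- (+ 4) ∷ + 0 ∷ ℤ.- (+ 10) ∷ + 0 ∷ ℤ.- (+ 4) ∷ + 1 ∷ []

toℚ : ℤ → ℚ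
toℚ z = z ℚ./ 1

evalPoly : List ℤ → ℚ → ℚ
evalPoly cs x = foldr (λ c acc → toℚ c ℚ.+ x ℚ.* acc) ℚ.0ℚ cs

fN : Case → ℚ → ℚ
fN c x = evalPoly (coeffs c) x

IsSquareℚ : ℚ → Set
IsSquareℚ r = ∃ λ q → q ℚ.* q ≡ r

-- squarefree integer (excludes 0, since 0 * 0 ∣ 0)
SquareFreeℤ : ℤ → Set
SquareFreeℤ d = (m : ℕ) → (m ℕ.* m) ℕD.∣ ∣ d ∣ → m ≡ 1

-- discriminant of ℚ(√d) for a squarefree integer d ≠ 1:
-- d if d ≡ 1 (mod 4), and 4d otherwise.
quadDisc : ℤ → ℤ
quadDisc d with d %ℕ 4
... | 1 = d
... | _ = + 4 ℤ.* d

-- The prime p ramifies in K = ℚ(√r) (r ∈ ℚ a nonsquare):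
-- writing r = d·q² with d squarefree (d is unique), p divides disc(K).
RamifiesIn√ : ℕ → ℚ → Set
RamifiesIn√ p r =
  Σ ℤ λ d → SquareFreeℤ d × (∃ λ q → r ≡ toℚ d ℚ.* (q ℚ.* q))
          × ((+ p) ℤD.∣ quadDisc d)

IsSquareMod : ℤ → ℕ → Set
IsSquareMod a p = ∃ λ z → (+ p) ℤD.∣ (z ℤ.* z ℤ.- a)

{-# OPTIONS --safe #-}
-- Each f_N is a norm from ℚ(√a): 4 f_N = G_N² − a H_N² for explicit G_N, H_N ∈ ℤ[x].
-- Hence if f_N(x₀) = d q² with d squarefree, clearing denominators gives integers with
-- X² − a Y² = d W² and W ≠ 0. An odd prime p ramified in ℚ(√d) divides d exactly once.
-- If p ∤ Y then a ≡ (X/Y)² (mod p); otherwise p divides X, hence p² divides d W², hence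
-- p divides W, and dividing X, Y, W by p gives a solution with smaller |W|.
-- The prime 2 needs no argument: every integer is a square modulo 2.
module Submission where

open import Defs
open import Data.Nat using (ℕ)
open import Data.Nat.Primality using (Prime)
open import Data.Rational using (ℚ)
open import Relation.Nullary using (¬_)
open import Relation.Binary.PropositionalEquality using (_≡_; _≢_)

open import Data.Nat as ℕ using (zero; suc; _≤_)
import Data.Nat.Properties as ℕP
import Data.Nat.Divisibility as ℕD
import Data.Nat.Coprimality as ℕC
open import Data.Nat.GCD using (module Bézout)
open import Data.Nat.Primality
  using (euclidsLemma; prime⇒irreducible; prime⇒nonZero; prime⇒nonTrivial; ¬prime[1]; irreducible[2])
open import Data.Integer as ℤ using (ℤ; +_; -[1+_]; ∣_∣; 1ℤ; _+_; _*_; _-_; -_; _%ℕ_; _/ℕ_)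
import Data.Integer.Properties as ℤP
open import Algebra.Properties.CommutativeSemigroup ℤP.*-commutativeSemigroup using (x∙yz≈y∙xz; x∙yz≈z∙xy; xy∙z≈xz∙y)
import Data.Integer.Divisibility as ℤD
open import Data.Integer.Divisibility.Signed
  using (_∣_; divides; _∣?_; ∣-refl; ∣ᵤ⇒∣; ∣⇒∣ᵤ; ∣m∣n⇒∣m+n; ∣n⇒∣m*n; ∣m⇒∣m*n)
open import Data.Integer.DivMod using (n%ℕd<d; a≡a%ℕn+[a/ℕn]*n)
open import Data.Integer.Tactic.RingSolver using (solve)
open import Data.Rational as ℚ using (mkℚ; ↥_; ↧_; 0ℚ; ½)
import Data.Rational.Properties as ℚP
import Data.Rational.Unnormalised as ℚᵘ
import Data.Rational.Unnormalised.Properties as ℚᵘP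
import Data.Rational.Solver as ℚSolver
module ℚRing = ℚSolver.+-*-Solver
open import Data.List using (List; []; _∷_)
import Data.Vec as Vec
open import Data.Fin using (zero)
open import Data.Product using (∃; ∃₂; _×_; _,_)
open import Data.Sum using (_⊎_; inj₁; inj₂; reduce)
open import Relation.Nullary using (yes; no; contradiction)
open import Relation.Binary.PropositionalEquality using (refl; sym; trans; cong; cong₂; subst; module ≡-Reasoning)

-- Unlike i / 1, the canonical form mkℚ i 0 makes the operations of ℚ compute,
-- which is all that toℚ-* and toℚ-+ need.
toℚ≡mkℚ : ∀ i → toℚ i ≡ mkℚ i 0 (ℕC.sym (ℕC.1-coprimeTo ∣ i ∣))
toℚ≡mkℚ i = ℚP.↥p/↧p≡p (mkℚ i 0 _)

toℚ-injective : ∀ {i j} → toℚ i ≡ toℚ j → i ≡ j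
toℚ-injective {i} {j} eq = cong ↥_ (trans (sym (toℚ≡mkℚ i)) (trans eq (toℚ≡mkℚ j)))

toℚ-* : ∀ i j → toℚ (i * j) ≡ toℚ i ℚ.* toℚ j
toℚ-* i j = sym (cong₂ ℚ._*_ (toℚ≡mkℚ i) (toℚ≡mkℚ j))

toℚ-+ : ∀ i j → toℚ (i + j) ≡ toℚ i ℚ.+ toℚ j
toℚ-+ i j = trans (ℚP./-cong {i + j} (sym (cong₂ _+_ (ℤP.*-identityʳ i) (ℤP.*-identityʳ j))) refl)
                  (sym (cong₂ ℚ._+_ (toℚ≡mkℚ i) (toℚ≡mkℚ j)))

toℚ-neg : ∀ i → toℚ (- i) ≡ ℚ.- toℚ i
toℚ-neg i = trans (toℚ≡mkℚ (- i)) (trans (neg-mkℚ i) (cong ℚ.-_ (sym (toℚ≡mkℚ i))))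
  where
  neg-mkℚ : ∀ i → mkℚ (- i) 0 (ℕC.sym (ℕC.1-coprimeTo ∣ - i ∣)) ≡ ℚ.- mkℚ i 0 (ℕC.sym (ℕC.1-coprimeTo ∣ i ∣))
  neg-mkℚ (+ zero)  = refl
  neg-mkℚ (+ suc n) = refl
  neg-mkℚ -[1+ n ]  = refl

toℚ-- : ∀ i j → toℚ (i - j) ≡ toℚ i ℚ.- toℚ j
toℚ-- i j = trans (toℚ-+ i (- j)) (cong (toℚ i ℚ.+_) (toℚ-neg j))

p*↧p≡↥p : ∀ p → p ℚ.* toℚ (↧ p) ≡ toℚ (↥ p)
p*↧p≡↥p p@(mkℚ n d _) = ℚP.toℚᵘ-injective (begin
  ℚ.toℚᵘ (p ℚ.* toℚ (↧ p))                ≈⟨ ℚP.toℚᵘ-homo-* p (toℚ (↧ p)) ⟩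
  ℚ.toℚᵘ p ℚᵘ.* ℚ.toℚᵘ (toℚ (↧ p))       ≡⟨ cong (λ r → ℚ.toℚᵘ p ℚᵘ.* ℚ.toℚᵘ r) (toℚ≡mkℚ (↧ p)) ⟩
  ℚᵘ.mkℚᵘ n d ℚᵘ.* ℚᵘ.mkℚᵘ (↧ p) 0       ≈⟨ ℚᵘ.*≡* (cross-multiply d) ⟩
  ℚᵘ.mkℚᵘ n 0                             ≡⟨ cong ℚ.toℚᵘ (toℚ≡mkℚ n) ⟨
  ℚ.toℚᵘ (toℚ n)                          ∎)
  where
  open ℚᵘP.≃-Reasoning
  cross-multiply : ∀ d → (n * + suc d) * 1ℤ ≡ n * + suc (d ℕ.* 1)
  cross-multiply d rewrite ℕP.*-identityʳ d = ℤP.*-identityʳ _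

p*[↧p*k]≡↥p*k : ∀ p k → p ℚ.* toℚ (↧ p * k) ≡ toℚ (↥ p * k)
p*[↧p*k]≡↥p*k p k = begin
  p ℚ.* toℚ (↧ p * k)            ≡⟨ cong (p ℚ.*_) (toℚ-* (↧ p) k) ⟩
  p ℚ.* (toℚ (↧ p) ℚ.* toℚ k)    ≡⟨ ℚP.*-assoc p (toℚ (↧ p)) (toℚ k) ⟨
  p ℚ.* toℚ (↧ p) ℚ.* toℚ k      ≡⟨ cong (ℚ._* toℚ k) (p*↧p≡↥p p) ⟩
  toℚ (↥ p) ℚ.* toℚ k            ≡⟨ toℚ-* (↥ p) k ⟨
  toℚ (↥ p * k)                  ∎
  where open ≡-Reasoning

norm-rescale : ∀ M a q G H t → M ℚ.* (q ℚ.* q) ≡ G ℚ.* G ℚ.- a ℚ.* (H ℚ.* H)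
  → M ℚ.* ((q ℚ.* t) ℚ.* (q ℚ.* t)) ≡ (G ℚ.* t) ℚ.* (G ℚ.* t) ℚ.- a ℚ.* ((H ℚ.* t) ℚ.* (H ℚ.* t))
norm-rescale M a q G H t eq = begin
  M ℚ.* ((q ℚ.* t) ℚ.* (q ℚ.* t))                   ≡⟨ ℚRing.solve 3 (λ M q t →
                                                          M :* ((q :* t) :* (q :* t)) := M :* (q :* q) :* (t :* t)) refl M q t ⟩
  M ℚ.* (q ℚ.* q) ℚ.* (t ℚ.* t)                     ≡⟨ cong (ℚ._* (t ℚ.* t)) eq ⟩
  (G ℚ.* G ℚ.- a ℚ.* (H ℚ.* H)) ℚ.* (t ℚ.* t)       ≡⟨ ℚRing.solve 4 (λ a G H t →
                                                          (G :* G :- a :* (H :* H)) :* (t :* t)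
                                                          := (G :* t) :* (G :* t) :- a :* ((H :* t) :* (H :* t))) refl a G H t ⟩
  (G ℚ.* t) ℚ.* (G ℚ.* t) ℚ.- a ℚ.* ((H ℚ.* t) ℚ.* (H ℚ.* t)) ∎
  where
  open ≡-Reasoning
  open ℚRing using (_:*_; _:-_; _:=_)

integral-rescaling : ∀ M a q G H t W X Y
  → q ℚ.* t ≡ toℚ W → G ℚ.* t ≡ toℚ X → H ℚ.* t ≡ toℚ Y
  → toℚ M ℚ.* (q ℚ.* q) ≡ G ℚ.* G ℚ.- toℚ a ℚ.* (H ℚ.* H)
  → M * (W * W) ≡ X * X - a * (Y * Y)
integral-rescaling M a q G H t W X Y qt≡W Gt≡X Ht≡Y eq = toℚ-injective (begin
  toℚ (M * (W * W))                                     ≡⟨ trans (toℚ-* M (W * W)) (cong (toℚ M ℚ.*_) (toℚ-* W W)) ⟩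
  toℚ M ℚ.* (toℚ W ℚ.* toℚ W)                           ≡⟨ cong (λ w → toℚ M ℚ.* (w ℚ.* w)) qt≡W ⟨
  toℚ M ℚ.* ((q ℚ.* t) ℚ.* (q ℚ.* t))                   ≡⟨ norm-rescale (toℚ M) (toℚ a) q G H t eq ⟩
  (G ℚ.* t) ℚ.* (G ℚ.* t) ℚ.- toℚ a ℚ.* ((H ℚ.* t) ℚ.* (H ℚ.* t))
                                                        ≡⟨ cong₂ (λ x y → x ℚ.* x ℚ.- toℚ a ℚ.* (y ℚ.* y)) Gt≡X Ht≡Y ⟩
  toℚ X ℚ.* toℚ X ℚ.- toℚ a ℚ.* (toℚ Y ℚ.* toℚ Y)       ≡⟨ cong₂ ℚ._-_ (toℚ-* X X)
                                                             (trans (toℚ-* a (Y * Y)) (cong (toℚ a ℚ.*_) (toℚ-* Y Y))) ⟨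
  toℚ (X * X) ℚ.- toℚ (a * (Y * Y))                     ≡⟨ toℚ-- (X * X) (a * (Y * Y)) ⟨
  toℚ (X * X - a * (Y * Y))                             ∎)
  where open ≡-Reasoning

clear-denominators : ∀ M a q G H → q ≢ 0ℚ
  → toℚ M ℚ.* (q ℚ.* q) ≡ G ℚ.* G ℚ.- toℚ a ℚ.* (H ℚ.* H)
  → ∃₂ λ X Y → ∃ λ W → ℤ.NonZero W × M * (W * W) ≡ X * X - a * (Y * Y)
clear-denominators M a q G H q≢0 eq = X , Y , W , W≢0 , integral-rescaling M a q G H t W X Y qt≡W Gt≡X Ht≡Y eq
  where
  t : ℚ
  t = toℚ (↧ q * (↧ G * ↧ H))
  W X Y : ℤ
  W = ↥ q * (↧ G * ↧ H)
  X = ↥ G * (↧ q * ↧ H)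
  Y = ↥ H * (↧ q * ↧ G)
  qt≡W : q ℚ.* t ≡ toℚ W
  qt≡W = p*[↧p*k]≡↥p*k q (↧ G * ↧ H)
  Gt≡X : G ℚ.* t ≡ toℚ X
  Gt≡X = trans (cong (λ e → G ℚ.* toℚ e) (x∙yz≈y∙xz (↧ q) (↧ G) (↧ H))) (p*[↧p*k]≡↥p*k G (↧ q * ↧ H))
  Ht≡Y : H ℚ.* t ≡ toℚ Y
  Ht≡Y = trans (cong (λ e → H ℚ.* toℚ e) (x∙yz≈z∙xy (↧ q) (↧ G) (↧ H))) (p*[↧p*k]≡↥p*k H (↧ q * ↧ G))
  W≢0 : ℤ.NonZero W
  W≢0 = ℤP.i*j≢0 (↥ q) (↧ G * ↧ H) {{ℤ.≢-nonZero (λ ↥q≡0 → q≢0 (ℚP.↥p≡0⇒p≡0 q ↥q≡0))}}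
                                   {{ℤP.i*j≢0 (↧ G) (↧ H)}}

euclidsLemmaℤ : ∀ {p} → Prime p → ∀ i j → + p ∣ i * j → (+ p ∣ i) ⊎ (+ p ∣ j)
euclidsLemmaℤ {p} p-prime i j p∣ij with euclidsLemma ∣ i ∣ ∣ j ∣ p-prime (subst (p ℕD.∣_) (ℤP.abs-* i j) (∣⇒∣ᵤ p∣ij))
... | inj₁ p∣i = inj₁ (∣ᵤ⇒∣ p∣i)
... | inj₂ p∣j = inj₂ (∣ᵤ⇒∣ p∣j)

prime∣i*i⇒prime∣i : ∀ {p i} → Prime p → + p ∣ i * i → + p ∣ i
prime∣i*i⇒prime∣i {i = i} p-prime p∣ii = reduce (euclidsLemmaℤ p-prime i i p∣ii)

prime∤⇒coprime : ∀ {p i} → Prime p → ¬ (+ p ∣ i) → ℕC.Coprime ∣ i ∣ p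
prime∤⇒coprime p-prime p∤i (e∣i , e∣p) with prime⇒irreducible p-prime e∣p
... | inj₁ e≡1 = e≡1
... | inj₂ refl = contradiction (∣ᵤ⇒∣ e∣i) p∤i

1+m*n≡o*q⇒ℤ : ∀ m n o q → 1 ℕ.+ m ℕ.* n ≡ o ℕ.* q → 1ℤ + + m * + n ≡ + o * + q
1+m*n≡o*q⇒ℤ m n o q eq = begin
  1ℤ + + m * + n      ≡⟨ cong (λ k → 1ℤ + k) (ℤP.pos-* m n) ⟨
  + (1 ℕ.+ m ℕ.* n)   ≡⟨ cong +_ eq ⟩
  + (o ℕ.* q)         ≡⟨ ℤP.pos-* o q ⟩
  + o * + q           ∎
  where open ≡-Reasoning

coprime⇒invertible : ∀ {n p} → ℕC.Coprime n p → ∃ λ u → + p ∣ u * + n - 1ℤ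
coprime⇒invertible {n} {p} coprime with ℕC.coprime-Bézout coprime
... | Bézout.+- x y eq = + x , divides (+ y) (begin
  + x * + n - 1ℤ          ≡⟨ cong (_- 1ℤ) (1+m*n≡o*q⇒ℤ y p x n eq) ⟨
  1ℤ + + y * + p - 1ℤ     ≡⟨ 1+i-1≡i (+ y * + p) ⟩
  + y * + p               ∎)
  where
  open ≡-Reasoning
  1+i-1≡i : ∀ i → 1ℤ + i - 1ℤ ≡ i
  1+i-1≡i i = solve (i ∷ [])
... | Bézout.-+ x y eq = - + x , divides (- + y) (begin
  - + x * + n - 1ℤ        ≡⟨ -i*j-1≡-[1+i*j] (+ x) (+ n) ⟩
  - (1ℤ + + x * + n)      ≡⟨ cong -_ (1+m*n≡o*q⇒ℤ x n y p eq) ⟩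
  - (+ y * + p)           ≡⟨ ℤP.neg-distribˡ-* (+ y) (+ p) ⟩
  - + y * + p             ∎)
  where
  open ≡-Reasoning
  -i*j-1≡-[1+i*j] : ∀ i j → - i * j - 1ℤ ≡ - (1ℤ + i * j)
  -i*j-1≡-[1+i*j] i j = solve (i ∷ j ∷ [])

prime∤⇒invertible : ∀ {p i} → Prime p → ¬ (+ p ∣ i) → ∃ λ u → + p ∣ u * i - 1ℤ
prime∤⇒invertible {p} {i} p-prime p∤i
  with coprime⇒invertible (prime∤⇒coprime p-prime p∤i) | ℤP.+∣i∣≡i⊎+∣i∣≡-i i
... | u , p∣u∣i∣-1 | inj₁ ∣i∣≡i  = u , subst (λ j → + p ∣ u * j - 1ℤ) ∣i∣≡i p∣u∣i∣-1
... | u , p∣u∣i∣-1 | inj₂ ∣i∣≡-i = - u , subst (λ j → + p ∣ j - 1ℤ) u*∣i∣≡-u*i p∣u∣i∣-1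
  where
  u*∣i∣≡-u*i : u * + ∣ i ∣ ≡ - u * i
  u*∣i∣≡-u*i = trans (cong (u *_) ∣i∣≡-i) (trans (sym (ℤP.neg-distribʳ-* u i)) (ℤP.neg-distribˡ-* u i))

isSquareMod-2 : ∀ a → IsSquareMod a 2
isSquareMod-2 a = a , ∣⇒∣ᵤ (by-remainder (a %ℕ 2) (a /ℕ 2) (n%ℕd<d a 2) (a≡a%ℕn+[a/ℕn]*n a 2))
  where
  open ≡-Reasoning
  by-remainder : ∀ r k → r ℕ.< 2 → a ≡ + r + k * + 2 → + 2 ∣ a * a - a
  by-remainder 0 k _ a≡2k = divides ((a - 1ℤ) * k) (begin
    a * a - a                    ≡⟨ solve (a ∷ []) ⟩
    (a - 1ℤ) * a                 ≡⟨ cong ((a - 1ℤ) *_) a≡2k ⟩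
    (a - 1ℤ) * (+ 0 + k * + 2)   ≡⟨ solve (a ∷ k ∷ []) ⟩
    (a - 1ℤ) * k * + 2           ∎)
  by-remainder 1 k _ a≡2k+1 = divides (a * k) (begin
    a * a - a                    ≡⟨ solve (a ∷ []) ⟩
    a * (a - 1ℤ)                 ≡⟨ cong (λ b → a * (b - 1ℤ)) a≡2k+1 ⟩
    a * (+ 1 + k * + 2 - 1ℤ)     ≡⟨ solve (a ∷ k ∷ []) ⟩
    a * k * + 2                  ∎)
  by-remainder (suc (suc _)) _ (ℕ.s≤s (ℕ.s≤s ())) _

module _ {p : ℕ} (p-prime : Prime p) (a : ℤ) where
  private
    P : ℤ
    P = + p
    instance
      P≢0 : ℤ.NonZero P
      P≢0 = prime⇒nonZero p-prime

  p∣X²-aY²∧p∤Y⇒isSquareMod : ∀ X Y → P ∣ X * X - a * (Y * Y) → ¬ (P ∣ Y) → IsSquareMod a p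
  p∣X²-aY²∧p∤Y⇒isSquareMod X Y p∣N p∤Y with prime∤⇒invertible p-prime p∤Y
  ... | u , p∣uY-1 = X * u , ∣⇒∣ᵤ (subst (P ∣_) (sym [Xu]²-a≡u²N+a[uY-1][uY+1])
          (∣m∣n⇒∣m+n (∣n⇒∣m*n (u * u) p∣N) (∣n⇒∣m*n a (∣m⇒∣m*n (u * Y + 1ℤ) p∣uY-1))))
    where
    [Xu]²-a≡u²N+a[uY-1][uY+1] : X * u * (X * u) - a ≡ u * u * (X * X - a * (Y * Y)) + a * ((u * Y - 1ℤ) * (u * Y + 1ℤ))
    [Xu]²-a≡u²N+a[uY-1][uY+1] = solve (X ∷ u ∷ a ∷ Y ∷ [])

  p∣X²-aY²∧p∣Y⇒p∣X : ∀ X Y → P ∣ X * X - a * (Y * Y) → P ∣ Y → P ∣ X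
  p∣X²-aY²∧p∣Y⇒p∣X X Y p∣N p∣Y =
    prime∣i*i⇒prime∣i p-prime (subst (P ∣_) X²-aY²+aY²≡X² (∣m∣n⇒∣m+n p∣N (∣n⇒∣m*n a (∣m⇒∣m*n Y p∣Y))))
    where
    X²-aY²+aY²≡X² : X * X - a * (Y * Y) + a * (Y * Y) ≡ X * X
    X²-aY²+aY²≡X² = solve (X ∷ a ∷ Y ∷ [])

  p∣m*p*W² : ∀ m W → P ∣ m * P * (W * W)
  p∣m*p*W² m W = ∣m⇒∣m*n (W * W) (∣n⇒∣m*n m (∣-refl {P}))

  cancel-p : ∀ j k m W → j * P * (j * P) - a * (k * P * (k * P)) ≡ m * P * (W * W)
    → (j * j - a * (k * k)) * P ≡ m * (W * W)
  cancel-p j k m W eq = ℤP.*-cancelʳ-≡ _ _ P (begin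
    (j * j - a * (k * k)) * P * P                ≡⟨ pull-out j k P ⟩
    j * P * (j * P) - a * (k * P * (k * P))      ≡⟨ eq ⟩
    m * P * (W * W)                              ≡⟨ xy∙z≈xz∙y m P (W * W) ⟩
    m * (W * W) * P                              ∎)
    where
    open ≡-Reasoning
    pull-out : ∀ j k π → (j * j - a * (k * k)) * π * π ≡ j * π * (j * π) - a * (k * π * (k * π))
    pull-out j k π = solve (j ∷ k ∷ a ∷ π ∷ [])

  p∤m⇒p∣W : ∀ r m W → ¬ (P ∣ m) → r * P ≡ m * (W * W) → P ∣ W
  p∤m⇒p∣W r m W p∤m eq with euclidsLemmaℤ p-prime m (W * W) (divides r (sym eq))
  ... | inj₁ p∣m  = contradiction p∣m p∤m
  ... | inj₂ p∣W² = prime∣i*i⇒prime∣i p-prime p∣W²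

  descent-step : ∀ X Y W m {{_ : ℤ.NonZero W}} → ¬ (P ∣ m) → P ∣ Y
    → X * X - a * (Y * Y) ≡ m * P * (W * W)
    → ∃₂ λ j k → ∃ λ l → ℤ.NonZero l × ∣ l ∣ ℕ.< ∣ W ∣ × j * j - a * (k * k) ≡ m * P * (l * l)
  descent-step X Y W m {{W≢0}} p∤m p∣Y eq
    with p∣X²-aY²∧p∣Y⇒p∣X X Y (subst (P ∣_) (sym eq) (p∣m*p*W² m W)) p∣Y | p∣Y
  ... | divides j refl | divides k refl with p∤m⇒p∣W (j * j - a * (k * k)) m W p∤m (cancel-p j k m W eq)
  ... | divides l refl = j , k , l , l≢0 , ∣l∣<∣lP∣ , ℤP.*-cancelʳ-≡ _ _ P (begin
    (j * j - a * (k * k)) * P      ≡⟨ cancel-p j k m (l * P) eq ⟩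
    m * (l * P * (l * P))          ≡⟨ regroup m l P ⟩
    m * P * (l * l) * P            ∎)
    where
    open ≡-Reasoning
    regroup : ∀ m l π → m * (l * π * (l * π)) ≡ m * π * (l * l) * π
    regroup m l π = solve (m ∷ l ∷ π ∷ [])
    l≢0 : ℤ.NonZero l
    l≢0 = ℕP.m*n≢0⇒m≢0 ∣ l ∣ {{subst ℕ.NonZero (ℤP.abs-* l P) W≢0}}
    ∣l∣<∣lP∣ : ∣ l ∣ ℕ.< ∣ l * P ∣
    ∣l∣<∣lP∣ = subst (∣ l ∣ ℕ.<_) (sym (ℤP.abs-* l P))
                 (ℕP.m<m*n ∣ l ∣ p {{l≢0}} (ℕ.nonTrivial⇒n>1 p {{prime⇒nonTrivial p-prime}}))

  descent : ∀ X Y W m {{_ : ℤ.NonZero W}} → ¬ (P ∣ m)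
    → X * X - a * (Y * Y) ≡ m * P * (W * W) → IsSquareMod a p
  descent X Y W m = bounded-descent ∣ W ∣ X Y W m ℕP.≤-refl
    where
    bounded-descent : ∀ n X Y W m {{_ : ℤ.NonZero W}} → ∣ W ∣ ≤ n → ¬ (P ∣ m)
      → X * X - a * (Y * Y) ≡ m * P * (W * W) → IsSquareMod a p
    bounded-descent zero X Y W m ∣W∣≤0 _ _ = contradiction ∣W∣≤0 (ℕP.<⇒≱ (ℕ.>-nonZero⁻¹ ∣ W ∣))
    bounded-descent (suc n) X Y W m ∣W∣≤1+n p∤m eq with P ∣? Y
    ... | no p∤Y = p∣X²-aY²∧p∤Y⇒isSquareMod X Y (subst (P ∣_) (sym eq) (p∣m*p*W² m W)) p∤Y
    ... | yes p∣Y with descent-step X Y W m p∤m p∣Y eq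
    ... | j , k , l , l≢0 , ∣l∣<∣W∣ , eq′ =
      bounded-descent n j k l m {{l≢0}} (ℕ.s≤s⁻¹ (ℕP.<-≤-trans ∣l∣<∣W∣ ∣W∣≤1+n)) p∤m eq′

squareFree⇒p∤cofactor : ∀ {p m} → Prime p → SquareFreeℤ (m * + p) → ¬ (+ p ∣ m)
squareFree⇒p∤cofactor {p} p-prime squareFree (divides t refl) =
  ¬prime[1] (subst Prime (squareFree p (ℕD.divides ∣ t ∣ ∣tpp∣≡∣t∣pp)) p-prime)
  where
  open ≡-Reasoning
  ∣tpp∣≡∣t∣pp : ∣ t * + p * + p ∣ ≡ ∣ t ∣ ℕ.* (p ℕ.* p)
  ∣tpp∣≡∣t∣pp = begin
    ∣ t * + p * + p ∣      ≡⟨ ℤP.abs-* (t * + p) (+ p) ⟩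
    ∣ t * + p ∣ ℕ.* p      ≡⟨ cong (ℕ._* p) (ℤP.abs-* t (+ p)) ⟩
    ∣ t ∣ ℕ.* p ℕ.* p      ≡⟨ ℕP.*-assoc ∣ t ∣ p p ⟩
    ∣ t ∣ ℕ.* (p ℕ.* p)    ∎

IsNormFrom√ : ℤ → ℚ → Set
IsNormFrom√ a r = ∃₂ λ G H → r ≡ G ℚ.* G ℚ.- toℚ a ℚ.* (H ℚ.* H)

p∣d∧dq²-isNorm⇒isSquareMod : ∀ {p a} d q → Prime p → SquareFreeℤ d → + p ∣ d → q ≢ 0ℚ
  → IsNormFrom√ a (toℚ d ℚ.* (q ℚ.* q)) → IsSquareMod a p
p∣d∧dq²-isNorm⇒isSquareMod {p} {a} _ q p-prime squareFree (divides m refl) q≢0 (G , H , dq²≡norm) =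
  let X , Y , W , W≢0 , dW²≡X²-aY² = clear-denominators (m * + p) a q G H q≢0 dq²≡norm
  in descent p-prime a X Y W m {{W≢0}} (squareFree⇒p∤cofactor p-prime squareFree) (sym dW²≡X²-aY²)

quadDisc≡d⊎4d : ∀ d → quadDisc d ≡ d ⊎ quadDisc d ≡ + 4 * d
quadDisc≡d⊎4d d with d %ℕ 4
... | 0           = inj₂ refl
... | 1           = inj₁ refl
... | suc (suc _) = inj₂ refl

p∣4⇒p≡2 : ∀ {p} → Prime p → p ℕD.∣ 4 → p ≡ 2
p∣4⇒p≡2 p-prime p∣4 with irreducible[2] (reduce (euclidsLemma 2 2 p-prime p∣4))
... | inj₁ refl = contradiction p-prime ¬prime[1]
... | inj₂ p≡2  = p≡2

ramified∧p≢2⇒p∣d : ∀ {p} d → Prime p → p ≢ 2 → + p ℤD.∣ quadDisc d → + p ∣ d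
ramified∧p≢2⇒p∣d {p} d p-prime p≢2 p∣disc with quadDisc≡d⊎4d d
... | inj₁ disc≡d  = ∣ᵤ⇒∣ (subst (+ p ℤD.∣_) disc≡d p∣disc)
... | inj₂ disc≡4d with euclidsLemmaℤ p-prime (+ 4) d (∣ᵤ⇒∣ (subst (+ p ℤD.∣_) disc≡4d p∣disc))
...   | inj₁ p∣4 = contradiction (p∣4⇒p≡2 p-prime (∣⇒∣ᵤ p∣4)) p≢2
...   | inj₂ p∣d = p∣d

horner : List ℤ → ℚRing.Polynomial 1
horner []       = ℚRing.con 0ℚ
horner (c ∷ cs) = ℚRing.con (toℚ c) ℚRing.:+ ℚRing.var zero ℚRing.:* horner cs

⟦horner⟧≡evalPoly : ∀ cs x → ℚRing.⟦ horner cs ⟧ Vec.[ x ] ≡ evalPoly cs x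
⟦horner⟧≡evalPoly []       x = refl
⟦horner⟧≡evalPoly (c ∷ cs) x = cong (λ r → toℚ c ℚ.+ x ℚ.* r) (⟦horner⟧≡evalPoly cs x)

-- 4 f_N = G_N² − a H_N², i.e. f_N is the norm of (G_N + H_N √a)/2 from ℚ(√a).
normG normH : Case → List ℤ
normG c26-13 = ℤ.- (+ 11) ∷ + 5 ∷ ℤ.- (+ 8) ∷ + 2 ∷ []
normG c28-m7 = + 4 ∷ ℤ.- (+ 6) ∷ ℤ.- (+ 6) ∷ + 4 ∷ []
normG c29-29 = ℤ.- (+ 1) ∷ + 13 ∷ ℤ.- (+ 4) ∷ + 2 ∷ []
normG c30-5 = + 12 ∷ + 42 ∷ + 35 ∷ + 14 ∷ + 2 ∷ []
normG c33-m11 = ℤ.- (+ 11) ∷ + 3 ∷ ℤ.- (+ 1) ∷ + 0 ∷ + 2 ∷ []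
normG c35-5 = + 3 ∷ ℤ.- (+ 4) ∷ + 10 ∷ ℤ.- (+ 4) ∷ + 2 ∷ []
normG c39-13 = + 2 ∷ ℤ.- (+ 6) ∷ + 7 ∷ ℤ.- (+ 6) ∷ + 2 ∷ []
normG c40-m1 = + 2 ∷ + 0 ∷ + 4 ∷ + 0 ∷ + 2 ∷ []
normG c40-5 = + 2 ∷ + 0 ∷ + 8 ∷ + 0 ∷ + 2 ∷ []
normG c41-41 = ℤ.- (+ 3) ∷ ℤ.- (+ 14) ∷ ℤ.- (+ 12) ∷ ℤ.- (+ 4) ∷ + 2 ∷ []
normG c48-m1 = ℤ.- (+ 2) ∷ + 0 ∷ + 0 ∷ + 0 ∷ + 2 ∷ []
normG c48-3 = + 2 ∷ + 0 ∷ + 12 ∷ + 0 ∷ + 2 ∷ []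
normG c50-5 = ℤ.- (+ 3) ∷ + 1 ∷ ℤ.- (+ 4) ∷ + 2 ∷ []
normH c26-13 = ℤ.- (+ 3) ∷ + 1 ∷ ℤ.- (+ 2) ∷ + 0 ∷ []
normH c28-m7 = + 0 ∷ + 4 ∷ ℤ.- (+ 4) ∷ + 0 ∷ []
normH c29-29 = ℤ.- (+ 1) ∷ + 1 ∷ ℤ.- (+ 2) ∷ + 0 ∷ []
normH c30-5 = + 4 ∷ + 14 ∷ + 9 ∷ + 2 ∷ + 0 ∷ []
normH c33-m11 = ℤ.- (+ 1) ∷ + 5 ∷ ℤ.- (+ 1) ∷ + 2 ∷ + 0 ∷ []
normH c35-5 = + 1 ∷ ℤ.- (+ 4) ∷ + 2 ∷ ℤ.- (+ 4) ∷ + 0 ∷ []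
normH c39-13 = + 0 ∷ + 2 ∷ ℤ.- (+ 3) ∷ + 2 ∷ + 0 ∷ []
normH c40-m1 = + 0 ∷ ℤ.- (+ 4) ∷ + 0 ∷ + 4 ∷ + 0 ∷ []
normH c40-5 = + 0 ∷ + 0 ∷ + 4 ∷ + 0 ∷ + 0 ∷ []
normH c41-41 = + 1 ∷ + 2 ∷ + 2 ∷ + 0 ∷ + 0 ∷ []
normH c48-m1 = + 0 ∷ + 0 ∷ + 8 ∷ + 0 ∷ + 0 ∷ []
normH c48-3 = + 0 ∷ ℤ.- (+ 4) ∷ + 0 ∷ ℤ.- (+ 4) ∷ + 0 ∷ []
normH c50-5 = ℤ.- (+ 1) ∷ ℤ.- (+ 1) ∷ ℤ.- (+ 2) ∷ + 0 ∷ []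

normExpr : Case → ℚRing.Polynomial 1
normExpr c = half (normG c) :* half (normG c) :- con (toℚ (aOf c)) :* (half (normH c) :* half (normH c))
  where
  open ℚRing using (Polynomial; con; _:*_; _:-_)
  half : List ℤ → Polynomial 1
  half cs = con ½ :* horner cs

fN≡norm-by-normalisation : ∀ c x → ℚRing.⟦ horner (coeffs c) ⟧↓ Vec.[ x ] ≡ ℚRing.⟦ normExpr c ⟧↓ Vec.[ x ]
fN≡norm-by-normalisation c26-13  x = refl
fN≡norm-by-normalisation c28-m7  x = refl
fN≡norm-by-normalisation c29-29  x = refl
fN≡norm-by-normalisation c30-5   x = refl
fN≡norm-by-normalisation c33-m11 x = refl
fN≡norm-by-normalisation c35-5   x = refl
fN≡norm-by-normalisation c39-13  x = refl
fN≡norm-by-normalisation c40-m1  x = refl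
fN≡norm-by-normalisation c40-5   x = refl
fN≡norm-by-normalisation c41-41  x = refl
fN≡norm-by-normalisation c48-m1  x = refl
fN≡norm-by-normalisation c48-3   x = refl
fN≡norm-by-normalisation c50-5   x = refl

fN-isNorm : ∀ c x → IsNormFrom√ (aOf c) (fN c x)
fN-isNorm c x = G , H , (begin
  fN c x                               ≡⟨ ⟦horner⟧≡evalPoly (coeffs c) x ⟨
  ℚRing.⟦ horner (coeffs c) ⟧ Vec.[ x ] ≡⟨ ℚRing.prove Vec.[ x ] (horner (coeffs c)) (normExpr c)
                                                         (fN≡norm-by-normalisation c x) ⟩
  ℚRing.⟦ normExpr c ⟧ Vec.[ x ]        ≡⟨ cong₂ (λ g h → ½ ℚ.* g ℚ.* (½ ℚ.* g) ℚ.- toℚ (aOf c) ℚ.* (½ ℚ.* h ℚ.* (½ ℚ.* h)))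
                                                 (⟦horner⟧≡evalPoly (normG c) x) (⟦horner⟧≡evalPoly (normH c) x) ⟩
  G ℚ.* G ℚ.- toℚ (aOf c) ℚ.* (H ℚ.* H) ∎)
  where
  open ≡-Reasoning
  G H : ℚ
  G = ½ ℚ.* evalPoly (normG c) x
  H = ½ ℚ.* evalPoly (normH c) x

theorem2p8 : (c : Case) (x₀ : ℚ)
    → ¬ IsSquareℚ (fN c x₀)
    → (p : ℕ) → Prime p
    → RamifiesIn√ p (fN c x₀)
    → (c ≡ c28-m7 → p ≢ 2)
    → IsSquareMod (aOf c) p
theorem2p8 c x₀ nonSquare p p-prime (d , squareFree , (q , fN≡dq²) , p∣disc) _ with p ℕP.≟ 2
... | yes refl = isSquareMod-2 (aOf c)
... | no p≢2   = p∣d∧dq²-isNorm⇒isSquareMod d q p-prime squareFree (ramified∧p≢2⇒p∣d d p-prime p≢2 p∣disc) q≢0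
                   (subst (IsNormFrom√ (aOf c)) fN≡dq² (fN-isNorm c x₀))
  where
  q≢0 : q ≢ 0ℚ
  q≢0 refl = nonSquare (0ℚ , sym (trans fN≡dq² (ℚP.*-zeroʳ (toℚ d))))
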